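{- Let $d\ge 1$, $n\ge 1$, $k\ge 0$ be integers. The number of $d$-ary multi-edge trees with $n$ vertices and $k$ leaves equals the number of $d$-ary trees with $n$ vertices and $k$ leaves.
   Context: A plane (ordered) rooted multi-edge tree is a rooted plane tree in which each non-root vertex is joined to its parent by a positive number of parallel edges; children of a vertex are linearly ordered. If a vertex has children joined to it by $k_1,\dots,k_r$ edges, its out-degree is $k_1+\dots+k_r$. A $d$-ary multi-edge tree is such a tree in which every vertex has out-degree at most $d$. A $d$-ary tree (pruned $d$-ary tree) is a rooted tree in which each vertex has $d$ distinct positions at which a child may be attached, each position holding at most one child. A leaf is a vertex with no children. -}

module Defs where

open import Data.Nat using (ℕ; zero; suc; _+_; _≤_)
open import Data.Product using (_×_; _,_)
open import Data.List using (List; []; _∷_)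
open import Data.Vec using (Vec; []; _∷_)
open import Data.Maybe using (Maybe; just; nothing)

-- A vertex is given by the ordered list of its children; each child is
-- paired with a natural number m, meaning it is joined to its parent by
-- (suc m) ≥ 1 parallel edges.

data MTree : Set where
  mnode : List (ℕ × MTree) → MTree

mutual
  msize : MTree → ℕ
  msize (mnode cs) = suc (msizes cs)

  msizes : List (ℕ × MTree) → ℕ
  msizes []            = 0
  msizes ((_ , t) ∷ cs) = msize t + msizes cs

mutual
  mleaves : MTree → ℕ
  mleaves (mnode [])       = 1
  mleaves (mnode (c ∷ cs)) = mleavesL (c ∷ cs)

  mleavesL : List (ℕ × MTree) → ℕ
  mleavesL []            = 0
  mleavesL ((_ , t) ∷ cs) = mleaves t + mleavesL cs

outdeg : List (ℕ × MTree) → ℕ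
outdeg []            = 0
outdeg ((m , _) ∷ cs) = suc m + outdeg cs

mutual
  data IsDAryM (d : ℕ) : MTree → Set where
    mnode : ∀ {cs} → outdeg cs ≤ d → AllDAryM d cs → IsDAryM d (mnode cs)

  data AllDAryM (d : ℕ) : List (ℕ × MTree) → Set where
    []  : AllDAryM d []
    _∷_ : ∀ {m t cs} → IsDAryM d t → AllDAryM d cs → AllDAryM d ((m , t) ∷ cs)

data DTree (d : ℕ) : Set where
  dnode : Vec (Maybe (DTree d)) d → DTree d

mutual
  dsize : ∀ {d} → DTree d → ℕ
  dsize (dnode cs) = suc (dsizes cs)

  dsizes : ∀ {d m} → Vec (Maybe (DTree d)) m → ℕ
  dsizes []             = 0
  dsizes (nothing ∷ cs) = dsizes cs
  dsizes (just t ∷ cs)  = dsize t + dsizes cs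

noChild : ∀ {A : Set} {m} → Vec (Maybe A) m → ℕ
noChild []             = 1
noChild (nothing ∷ cs) = noChild cs
noChild (just _ ∷ _)   = 0

mutual
  dleaves : ∀ {d} → DTree d → ℕ
  dleaves (dnode cs) = noChild cs + dleavesV cs

  dleavesV : ∀ {d m} → Vec (Maybe (DTree d)) m → ℕ
  dleavesV []             = 0
  dleavesV (nothing ∷ cs) = dleavesV cs
  dleavesV (just t ∷ cs)  = dleaves t + dleavesV cs

-- Read a run of j empty positions of a d-ary tree vertex, followed by a child, as j extra
-- parallel edges to that child, and forget the empty positions after the last child. This
-- turns a d-ary tree into a multi-edge tree whose root out-degree is the position of the last
-- child, hence at most d, and it is a bijection onto d-ary multi-edge trees that keeps every
-- vertex and every leaf. Both sides are finite since a d-ary tree with n vertices occurs in an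
-- explicit list of the d-ary trees with at most n vertices.
module Submission where

open import Defs
open import Data.Nat using (ℕ; zero; suc; _+_; _≤_; z≤n; s≤s; _≟_)
open import Data.Nat.Properties using (≤-irrelevant; ≤-trans; ≤-reflexive; m≤m+n; m≤n+m; ≡-irrelevant)
open import Data.Fin using (Fin; zero; suc)
open import Data.Product using (Σ; ∃; _×_; _,_; proj₁; proj₂; uncurry)
open import Data.Product.Properties using (Σ-≡,≡→≡; ×-≡,≡→≡)
open import Data.Product.Function.Dependent.Propositional using (Σ-↔)
open import Data.List using (List; []; _∷_; length; lookup; filter; deduplicate; map; cartesianProduct)
open import Data.List.Membership.Propositional using (_∈_)
open import Data.List.Membership.Propositional.Properties
  using (∈-filter⁺; ∈-filter⁻; ∈-deduplicate⁺; ∈-deduplicate⁻; ∈-lookup; ∈-map⁺; ∈-cartesianProduct⁺)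
open import Data.List.Membership.Setoid.Properties using (unique⇒irrelevant)
open import Data.List.Relation.Unary.Any using (index; here; there)
open import Data.List.Relation.Unary.Any.Properties using (lookup-index)
open import Data.List.Relation.Unary.Unique.DecPropositional.Properties using (deduplicate-!)
open import Data.Vec using (Vec; []; _∷_; replicate)
open import Data.Maybe using (Maybe; just; nothing)
open import Axiom.UniquenessOfIdentityProofs using (module Decidable⇒UIP)
open import Function.Bundles using (_↔_; mk↔ₛ′)
open import Function.Properties.Inverse using (↔-refl; ↔-sym; ↔-trans)
open import Function.Related.TypeIsomorphisms using (Σ-assoc)
open import Relation.Binary.PropositionalEquality using (_≡_; refl; sym; trans; cong; cong₂; setoid)
open import Relation.Binary.Definitions using (DecidableEquality)
open import Relation.Nullary using (yes; no)
open import Relation.Nullary.Decidable using (map′; _×-dec_)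
open import Relation.Unary using (Decidable; Irrelevant)

index-∈-lookup : ∀ {A : Set} (xs : List A) i → index (∈-lookup {xs = xs} i) ≡ i
index-∈-lookup (_ ∷ _)  zero    = refl
index-∈-lookup (_ ∷ xs) (suc i) = cong suc (index-∈-lookup xs i)

covered⇒finite : ∀ {A : Set} {P : A → Set} → DecidableEquality A → Decidable P → Irrelevant P →
                 (xs : List A) → (∀ {a} → P a → a ∈ xs) → ∃ λ N → Σ A P ↔ Fin N
covered⇒finite {A} {P} _≟ᴬ_ P? P-irrelevant xs covers = length ys , mk↔ₛ′ to from to∘from from∘to
  where
  ys : List A
  ys = deduplicate _≟ᴬ_ (filter P? xs)

  ∈ys : ∀ {a} → P a → a ∈ ys
  ∈ys p = ∈-deduplicate⁺ _≟ᴬ_ (∈-filter⁺ P? (covers p) p)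

  ∈ys-irrelevant : ∀ {a} (i j : a ∈ ys) → i ≡ j
  ∈ys-irrelevant = unique⇒irrelevant (setoid A) (Decidable⇒UIP.≡-irrelevant _≟ᴬ_)
                                     (deduplicate-! _≟ᴬ_ (filter P? xs))

  to : Σ A P → Fin (length ys)
  to (_ , p) = index (∈ys p)

  from : Fin (length ys) → Σ A P
  from i = lookup ys i , proj₂ (∈-filter⁻ P? {xs = xs} (∈-deduplicate⁻ _≟ᴬ_ (filter P? xs) (∈-lookup i)))

  to∘from : ∀ i → to (from i) ≡ i
  to∘from i = trans (cong index (∈ys-irrelevant _ _)) (index-∈-lookup ys i)

  from∘to : ∀ x → from (to x) ≡ x
  from∘to (_ , p) = Σ-≡,≡→≡ (sym (lookup-index (∈ys p)) , P-irrelevant _ _)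

maybeVecsOver : ∀ {A : Set} → List A → (m : ℕ) → List (Vec (Maybe A) m)
maybeVecsOver xs zero    = [] ∷ []
maybeVecsOver xs (suc m) = map (λ (x , v) → x ∷ v) (cartesianProduct (nothing ∷ map just xs) (maybeVecsOver xs m))

∈-maybeVecsOver-∷ : ∀ {A : Set} {xs : List A} {m} {x : Maybe A} {v : Vec (Maybe A) m} →
                    x ∈ nothing ∷ map just xs → v ∈ maybeVecsOver xs m → x ∷ v ∈ maybeVecsOver xs (suc m)
∈-maybeVecsOver-∷ x∈ v∈ = ∈-map⁺ (λ (x , v) → x ∷ v) (∈-cartesianProduct⁺ x∈ v∈)

addEdgeToFirst : List (ℕ × MTree) → List (ℕ × MTree)
addEdgeToFirst []             = []
addEdgeToFirst ((j , t) ∷ cs) = (suc j , t) ∷ cs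

outdeg-addEdgeToFirst : ∀ {m} cs → outdeg cs ≤ m → outdeg (addEdgeToFirst cs) ≤ suc m
outdeg-addEdgeToFirst []      _ = z≤n
outdeg-addEdgeToFirst (_ ∷ _) p = s≤s p

msizes-addEdgeToFirst : ∀ cs → msizes (addEdgeToFirst cs) ≡ msizes cs
msizes-addEdgeToFirst []      = refl
msizes-addEdgeToFirst (_ ∷ _) = refl

mleaves-addEdgeToFirst : ∀ cs → mleaves (mnode (addEdgeToFirst cs)) ≡ mleaves (mnode cs)
mleaves-addEdgeToFirst []      = refl
mleaves-addEdgeToFirst (_ ∷ _) = refl

mleavesL-addEdgeToFirst : ∀ cs → mleavesL (addEdgeToFirst cs) ≡ mleavesL cs
mleavesL-addEdgeToFirst []      = refl
mleavesL-addEdgeToFirst (_ ∷ _) = refl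

module _ {d : ℕ} where

  allDAryM-addEdgeToFirst : ∀ {cs} → AllDAryM d cs → AllDAryM d (addEdgeToFirst cs)
  allDAryM-addEdgeToFirst []         = []
  allDAryM-addEdgeToFirst (dt ∷ dcs) = dt ∷ dcs

  mutual
    isDAryM-irrelevant : Irrelevant (IsDAryM d)
    isDAryM-irrelevant (mnode p dcs) (mnode q dcs′) = cong₂ mnode (≤-irrelevant p q) (allDAryM-irrelevant dcs dcs′)

    allDAryM-irrelevant : Irrelevant (AllDAryM d)
    allDAryM-irrelevant []         []           = refl
    allDAryM-irrelevant (dt ∷ dcs) (dt′ ∷ dcs′) = cong₂ _∷_ (isDAryM-irrelevant dt dt′) (allDAryM-irrelevant dcs dcs′)

  mutual
    dtree-≟ : DecidableEquality (DTree d)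
    dtree-≟ (dnode u) (dnode v) = map′ (cong dnode) (λ { refl → refl }) (positions-≟ u v)

    positions-≟ : ∀ {m} → DecidableEquality (Vec (Maybe (DTree d)) m)
    positions-≟ []      []      = yes refl
    positions-≟ (x ∷ u) (y ∷ v) = map′ (uncurry (cong₂ _∷_)) (λ { refl → refl , refl }) (position-≟ x y ×-dec positions-≟ u v)

    position-≟ : DecidableEquality (Maybe (DTree d))
    position-≟ nothing  nothing  = yes refl
    position-≟ (just s) (just t) = map′ (cong just) (λ { refl → refl }) (dtree-≟ s t)
    position-≟ nothing  (just _) = no λ ()
    position-≟ (just _) nothing  = no λ ()

  dtreesOfSize≤ : ℕ → List (DTree d)
  dtreesOfSize≤ zero    = []
  dtreesOfSize≤ (suc b) = map dnode (maybeVecsOver (dtreesOfSize≤ b) d)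

  mutual
    ∈-dtreesOfSize≤ : (t : DTree d) {b : ℕ} → dsize t ≤ b → t ∈ dtreesOfSize≤ b
    ∈-dtreesOfSize≤ (dnode v) {suc b} (s≤s p) = ∈-map⁺ dnode (∈-positionsOfSize≤ v p)

    ∈-positionsOfSize≤ : ∀ {m} (v : Vec (Maybe (DTree d)) m) {b} → dsizes v ≤ b →
                         v ∈ maybeVecsOver (dtreesOfSize≤ b) m
    ∈-positionsOfSize≤ []            p = here refl
    ∈-positionsOfSize≤ (nothing ∷ v) p = ∈-maybeVecsOver-∷ (here refl) (∈-positionsOfSize≤ v p)
    ∈-positionsOfSize≤ (just t ∷ v)  p = ∈-maybeVecsOver-∷
      (there (∈-map⁺ just (∈-dtreesOfSize≤ t (≤-trans (m≤m+n _ _) p))))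
      (∈-positionsOfSize≤ v (≤-trans (m≤n+m _ _) p))

  mutual
    toMulti : DTree d → MTree
    toMulti (dnode v) = mnode (childEdges v)

    childEdges : ∀ {m} → Vec (Maybe (DTree d)) m → List (ℕ × MTree)
    childEdges []            = []
    childEdges (nothing ∷ v) = addEdgeToFirst (childEdges v)
    childEdges (just t ∷ v)  = (0 , toMulti t) ∷ childEdges v

  outdeg-childEdges : ∀ {m} (v : Vec (Maybe (DTree d)) m) → outdeg (childEdges v) ≤ m
  outdeg-childEdges []            = z≤n
  outdeg-childEdges (nothing ∷ v) = outdeg-addEdgeToFirst (childEdges v) (outdeg-childEdges v)
  outdeg-childEdges (just _ ∷ v)  = s≤s (outdeg-childEdges v)

  mutual
    toMulti-isDAryM : (t : DTree d) → IsDAryM d (toMulti t)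
    toMulti-isDAryM (dnode v) = mnode (outdeg-childEdges v) (childEdges-allDAryM v)

    childEdges-allDAryM : ∀ {m} (v : Vec (Maybe (DTree d)) m) → AllDAryM d (childEdges v)
    childEdges-allDAryM []            = []
    childEdges-allDAryM (nothing ∷ v) = allDAryM-addEdgeToFirst (childEdges-allDAryM v)
    childEdges-allDAryM (just t ∷ v)  = toMulti-isDAryM t ∷ childEdges-allDAryM v

  mutual
    fromMulti : (t : MTree) → IsDAryM d t → DTree d
    fromMulti (mnode cs) (mnode cs≤d dcs) = dnode (positions d cs dcs cs≤d)

    positions : (m : ℕ) (cs : List (ℕ × MTree)) → AllDAryM d cs → outdeg cs ≤ m → Vec (Maybe (DTree d)) m
    positions m []             _          _ = replicate m nothing
    positions m ((j , t) ∷ cs) (dt ∷ dcs) p = positionsAfterGap m j t dt cs dcs p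

    positionsAfterGap : (m j : ℕ) (t : MTree) → IsDAryM d t → (cs : List (ℕ × MTree)) → AllDAryM d cs →
                        suc j + outdeg cs ≤ m → Vec (Maybe (DTree d)) m
    positionsAfterGap (suc m) zero    t dt cs dcs (s≤s p) = just (fromMulti t dt) ∷ positions m cs dcs p
    positionsAfterGap (suc m) (suc j) t dt cs dcs (s≤s p) = nothing ∷ positionsAfterGap m j t dt cs dcs p

  childEdges-replicate : ∀ m → childEdges (replicate m nothing) ≡ []
  childEdges-replicate zero    = refl
  childEdges-replicate (suc m) = cong addEdgeToFirst (childEdges-replicate m)

  mutual
    toMulti-fromMulti : (t : MTree) (dt : IsDAryM d t) → toMulti (fromMulti t dt) ≡ t
    toMulti-fromMulti (mnode cs) (mnode cs≤d dcs) = cong mnode (childEdges-positions d cs dcs cs≤d)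

    childEdges-positions : ∀ m cs (dcs : AllDAryM d cs) (p : outdeg cs ≤ m) → childEdges (positions m cs dcs p) ≡ cs
    childEdges-positions m []             _          _ = childEdges-replicate m
    childEdges-positions m ((j , t) ∷ cs) (dt ∷ dcs) p = childEdges-positionsAfterGap m j t dt cs dcs p

    childEdges-positionsAfterGap : ∀ m j t (dt : IsDAryM d t) cs (dcs : AllDAryM d cs) (p : suc j + outdeg cs ≤ m) →
                                   childEdges (positionsAfterGap m j t dt cs dcs p) ≡ (j , t) ∷ cs
    childEdges-positionsAfterGap (suc m) zero    t dt cs dcs (s≤s p) =
      cong₂ (λ t′ cs′ → (0 , t′) ∷ cs′) (toMulti-fromMulti t dt) (childEdges-positions m cs dcs p)
    childEdges-positionsAfterGap (suc m) (suc j) t dt cs dcs (s≤s p) =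
      cong addEdgeToFirst (childEdges-positionsAfterGap m j t dt cs dcs p)

  positions-addEdgeToFirst : ∀ {m} cs (v : Vec (Maybe (DTree d)) m) →
                             (∀ dcs p → positions m cs dcs p ≡ v) →
                             ∀ dcs p → positions (suc m) (addEdgeToFirst cs) dcs p ≡ nothing ∷ v
  positions-addEdgeToFirst []      v eq dcs        p       = cong (nothing ∷_) (eq [] z≤n)
  positions-addEdgeToFirst (_ ∷ _) v eq (dt ∷ dcs) (s≤s p) = cong (nothing ∷_) (eq (dt ∷ dcs) p)

  mutual
    fromMulti-toMulti : (t : DTree d) (dt : IsDAryM d (toMulti t)) → fromMulti (toMulti t) dt ≡ t
    fromMulti-toMulti (dnode v) (mnode p dcs) = cong dnode (positions-childEdges v dcs p)

    positions-childEdges : ∀ {m} (v : Vec (Maybe (DTree d)) m) dcs p → positions m (childEdges v) dcs p ≡ v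
    positions-childEdges []            _          _       = refl
    positions-childEdges (nothing ∷ v) dcs        p       =
      positions-addEdgeToFirst (childEdges v) v (positions-childEdges v) dcs p
    positions-childEdges (just t ∷ v)  (dt ∷ dcs) (s≤s p) =
      cong₂ (λ t′ v′ → just t′ ∷ v′) (fromMulti-toMulti t dt) (positions-childEdges v dcs p)

  dtree↔dAryMTree : DTree d ↔ Σ MTree (IsDAryM d)
  dtree↔dAryMTree = mk↔ₛ′ (λ t → toMulti t , toMulti-isDAryM t) (uncurry fromMulti)
    (λ (t , dt) → Σ-≡,≡→≡ (toMulti-fromMulti t dt , isDAryM-irrelevant _ _))
    (λ t → fromMulti-toMulti t _)

  mutual
    msize-toMulti : (t : DTree d) → msize (toMulti t) ≡ dsize t
    msize-toMulti (dnode v) = cong suc (msizes-childEdges v)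

    msizes-childEdges : ∀ {m} (v : Vec (Maybe (DTree d)) m) → msizes (childEdges v) ≡ dsizes v
    msizes-childEdges []            = refl
    msizes-childEdges (nothing ∷ v) = trans (msizes-addEdgeToFirst (childEdges v)) (msizes-childEdges v)
    msizes-childEdges (just t ∷ v)  = cong₂ _+_ (msize-toMulti t) (msizes-childEdges v)

  mutual
    mleaves-toMulti : (t : DTree d) → mleaves (toMulti t) ≡ dleaves t
    mleaves-toMulti (dnode v) = mleaves-mnode-childEdges v

    mleaves-mnode-childEdges : ∀ {m} (v : Vec (Maybe (DTree d)) m) →
                               mleaves (mnode (childEdges v)) ≡ noChild v + dleavesV v
    mleaves-mnode-childEdges []            = refl
    mleaves-mnode-childEdges (nothing ∷ v) =
      trans (mleaves-addEdgeToFirst (childEdges v)) (mleaves-mnode-childEdges v)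
    mleaves-mnode-childEdges (just t ∷ v)  = cong₂ _+_ (mleaves-toMulti t) (mleavesL-childEdges v)

    mleavesL-childEdges : ∀ {m} (v : Vec (Maybe (DTree d)) m) → mleavesL (childEdges v) ≡ dleavesV v
    mleavesL-childEdges []            = refl
    mleavesL-childEdges (nothing ∷ v) = trans (mleavesL-addEdgeToFirst (childEdges v)) (mleavesL-childEdges v)
    mleavesL-childEdges (just t ∷ v)  = cong₂ _+_ (mleaves-toMulti t) (mleavesL-childEdges v)

  size×leaves-toMulti : ∀ {n k} (t : DTree d) →
                        (dsize t ≡ n × dleaves t ≡ k) ↔ (msize (toMulti t) ≡ n × mleaves (toMulti t) ≡ k)
  size×leaves-toMulti t rewrite msize-toMulti t | mleaves-toMulti t = ↔-refl

dAryMTrees↔dtrees : ∀ d n k → Σ MTree (λ t → IsDAryM d t × msize t ≡ n × mleaves t ≡ k)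
                            ↔ Σ (DTree d) (λ t → dsize t ≡ n × dleaves t ≡ k)
dAryMTrees↔dtrees d n k = ↔-trans (↔-sym Σ-assoc) (↔-sym (Σ-↔ dtree↔dAryMTree (λ {t} → size×leaves-toMulti t)))

dtrees-finite : ∀ d n k → ∃ λ N → Σ (DTree d) (λ t → dsize t ≡ n × dleaves t ≡ k) ↔ Fin N
dtrees-finite d n k = covered⇒finite dtree-≟
  (λ t → (dsize t ≟ n) ×-dec (dleaves t ≟ k))
  (λ (p , q) (p′ , q′) → ×-≡,≡→≡ (≡-irrelevant p p′ , ≡-irrelevant q q′))
  (dtreesOfSize≤ n)
  (λ (size≡n , _) → ∈-dtreesOfSize≤ _ (≤-reflexive size≡n))

corollary2p5 : (d n k : ℕ) → 1 ≤ d → 1 ≤ n →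
    Σ ℕ (λ N →
      (Σ MTree (λ t → IsDAryM d t × msize t ≡ n × mleaves t ≡ k) ↔ Fin N)
      × (Σ (DTree d) (λ t → dsize t ≡ n × dleaves t ≡ k) ↔ Fin N))
corollary2p5 d n k _ _ = N , ↔-trans (dAryMTrees↔dtrees d n k) dtrees↔Fin , dtrees↔Fin
  where
  N : ℕ
  N = proj₁ (dtrees-finite d n k)
  dtrees↔Fin : Σ (DTree d) (λ t → dsize t ≡ n × dleaves t ≡ k) ↔ Fin N
  dtrees↔Fin = proj₂ (dtrees-finite d n k)
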